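{- Let $G$ be a finite simple graph, let $d\ge 0$ be an integer, and let $<$ be an arbitrary linear ordering of $V(G)$. Then $\operatorname{tww}(G)\le d$ if and only if there exists a twin-width decomposition $(T,\prec)$ of $G$ of width at most $d$ such that (1) whenever $x$ is the parent of $y$ in $T$, we have $y < x$; and (2) the root of $T$ is the $<$-maximal element of $V(G)$.
   Context: A trigraph is a graph whose edge set is partitioned into black edges and red edges; an ordinary graph is a trigraph with all edges black. $N_G(v)$ denotes the set of all (black or red) neighbours of $v$; the red degree of $v$ is its number of red neighbours; a $d$-trigraph is a trigraph in which every vertex has red degree at most $d$. Contracting two distinct (not necessarily adjacent) vertices $u,v$ of a trigraph means replacing them by a single new vertex $w$: every vertex of $N(u)\triangle N(v)$ (other than $u,v$) becomes a red neighbour of $w$; a vertex $x\in N(u)\cap N(v)$ becomes a black neighbour of $w$ if $xu$ and $xv$ are both black, and a red neighbour of $w$ otherwise; all edges not incident with $u$ or $v$ are unchanged. A $d$-sequence for an $n$-vertex graph $G$ is a sequence of $d$-trigraphs $G_0=G,G_1,\dots,G_{n-1}$ where each $G_i$ ($i\ge1$) is obtained from $G_{i-1}$ by one contraction and $G_{n-1}$ has a single vertex. The twin-width $\operatorname{tww}(G)$ is the least $d$ such that $G$ has a $d$-sequence. A twin-width decomposition of $G$ is a pair $(T,\prec)$ where $T$ is a rooted tree with $V(T)=V(G)$ (the contraction tree) and $\prec$ is a linear ordering of $V(G)$ (the elimination ordering) such that $u\prec v$ whenever $v$ is the parent of $u$ in $T$. Writing $V(G)=\{v_1,\dots,v_n\}$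 with $v_1\prec\dots\prec v_n$ (so $v_n$ is the root) and $p_i$ for the parent of $v_i$ in $T$ ($i<n$), define graphs $H_0,\dots,H_{n-1}$ with $V(H_i)=\{v_{i+1},\dots,v_n\}$, $E(H_0)=\emptyset$, and for $1\le i<n$, $E(H_i)$ is the union of: $\{uv\in E(H_{i-1}) : u,v\in V(H_i)\}$; $\{up_i : v_iu\in E(H_{i-1})\}$; $\{up_i : v_iu\in E(G),\ p_iu\notin E(G),\ u\in V(H_i)\}$; $\{up_i : v_iu\notin E(G),\ p_iu\in E(G),\ u\in V(H_i)\}$ (edges are unordered pairs of distinct vertices). This is the elimination sequence defined by $(T,\prec)$. The width of $(T,\prec)$ is the least $d$ such that every $H_i$ has maximum degree at most $d$. -}

module Defs where

open import Data.Nat using (ℕ; zero; suc; _≤_; _<_; _≤ᵇ_; _<?_)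
open import Data.Fin using (Fin; toℕ; fromℕ<) renaming (_<_ to _<ᶠ_)
open import Data.Fin.Properties using (_≟_)
open import Data.Bool using (Bool; true; false; _∧_; _∨_; not; _xor_; if_then_else_)
open import Data.List using (List; allFin; map)
open import Data.Maybe using (Maybe; just; nothing)
open import Data.Product using (Σ; _×_; ∃)
open import Data.Sum using (_⊎_)
open import Relation.Nullary using (¬_; yes; no; does)
open import Relation.Binary.PropositionalEquality using (_≡_; _≢_; refl)
open import Function.Bundles using (_↔_; Inverse)

record Graph (N : ℕ) : Set where
  field
    adj    : Fin N → Fin N → Bool
    sym    : ∀ a b → adj a b ≡ adj b a
    irrefl : ∀ a → adj a a ≡ false
open Graph public

countTrue : List Bool → ℕ
countTrue List.[] = 0
countTrue (true List.∷ bs) = suc (countTrue bs)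
countTrue (false List.∷ bs) = countTrue bs

data Edge : Set where
  none black red : Edge

isRed : Edge → Bool
isRed red = true
isRed _   = false

record Trigraph (k : ℕ) : Set where
  field
    edge   : Fin k → Fin k → Edge
    esym   : ∀ a b → edge a b ≡ edge b a
    eirref : ∀ a → edge a a ≡ none
open Trigraph public

redDegree : ∀ {k} → Trigraph k → Fin k → ℕ
redDegree {k} T x = countTrue (map (λ y → isRed (edge T x y)) (allFin k))

IsDTrigraph : ℕ → ∀ {k} → Trigraph k → Set
IsDTrigraph d {k} T = ∀ (x : Fin k) → redDegree T x ≤ d

private
  bw : Bool → Edge
  bw x = if x then black else none

  bw-cong : ∀ x y → x ≡ y → bw x ≡ bw y
  bw-cong x .x refl = refl

  bw-false : ∀ x → x ≡ false → bw x ≡ none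
  bw-false .false refl = refl

toTrigraph : ∀ {N} → Graph N → Trigraph N
toTrigraph G = record
  { edge   = λ a b → bw (adj G a b)
  ; esym   = λ a b → bw-cong (adj G a b) (adj G b a) (sym G a b)
  ; eirref = λ a → bw-false (adj G a a) (irrefl G a) }

-- colour of the edge w x after contracting u,v into w, where
-- e₁ = edge u x and e₂ = edge v x
combine : Edge → Edge → Edge
combine none  none  = none
combine black black = black
combine _     _     = red

InUV : ∀ {m} → Fin m → Fin m → Fin m → Set
InUV u v a = a ≡ u ⊎ a ≡ v

-- The map f sends each vertex of T to its image in T':
-- u and v both go to the new vertex w = f u, and f is injective otherwise.
Contraction : ∀ {k} → Trigraph (suc k) → Trigraph k → Set
Contraction {k} T T' =
  Σ (Fin (suc k)) λ u → Σ (Fin (suc k)) λ v → u ≢ v ×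
  Σ (Fin (suc k) → Fin k) λ f →
    f u ≡ f v ×
    (∀ a b → f a ≡ f b → a ≡ b ⊎ (InUV u v a × InUV u v b)) ×
    (∀ a b → ¬ InUV u v a → ¬ InUV u v b → edge T' (f a) (f b) ≡ edge T a b) ×
    (∀ x → ¬ InUV u v x → edge T' (f u) (f x) ≡ combine (edge T u x) (edge T v x))

data ContrSeq (d : ℕ) : ∀ {k} → Trigraph (suc k) → Set where
  done : (T : Trigraph 1) → ContrSeq d T
  step : ∀ {k} {T : Trigraph (suc (suc k))} (T' : Trigraph (suc k)) →
         Contraction T T' → IsDTrigraph d T' → ContrSeq d T' → ContrSeq d T

HasDSequence : ∀ {n} → Graph (suc n) → ℕ → Set
HasDSequence G d = IsDTrigraph d (toTrigraph G) × ContrSeq d (toTrigraph G)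

TwwLe : ∀ {n} → Graph (suc n) → ℕ → Set
TwwLe G d = Σ ℕ λ d' → d' ≤ d × HasDSequence G d'

iterParent : ∀ {N} → (Fin N → Maybe (Fin N)) → ℕ → Fin N → Maybe (Fin N)
iterParent p zero    v = just v
iterParent p (suc k) v with p v
... | nothing = nothing
... | just w  = iterParent p k w

record RootedTree (N : ℕ) : Set where
  field
    root      : Fin N
    parent    : Fin N → Maybe (Fin N)
    rootOnly  : ∀ v → (parent v ≡ nothing → v ≡ root) × (v ≡ root → parent v ≡ nothing)
    reachRoot : ∀ v → Σ ℕ λ k → iterParent parent k v ≡ just root

-- Twin-width decomposition (T, ≺): the elimination ordering is given by a
-- bijection `pos` from vertices to positions 0..N-1 (v_{i+1} has position i).
record TWDecomp {N : ℕ} (G : Graph N) : Set where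
  field
    tree   : RootedTree N
    pos    : Fin N ↔ Fin N
    compat : ∀ u v → RootedTree.parent tree u ≡ just v →
             Inverse.to pos u <ᶠ Inverse.to pos v
  open RootedTree tree public

module _ {N : ℕ} (G : Graph N) (D : TWDecomp G) where
  open TWDecomp D

  eqᵇ : Fin N → Fin N → Bool
  eqᵇ a b = does (a ≟ b)

  -- v is a vertex of H_i iff its position is ≥ i
  alive : ℕ → Fin N → Bool
  alive i v = i ≤ᵇ toℕ (Inverse.to pos v)

  vertexAt : ℕ → Maybe (Fin N)
  vertexAt i with i <? N
  ... | yes p = just (Inverse.from pos (fromℕ< p))
  ... | no _  = nothing

  H : ℕ → Fin N → Fin N → Bool
  H zero    a b = false
  H (suc i) a b =
    alive (suc i) a ∧ alive (suc i) b ∧ not (eqᵇ a b) ∧ (H i a b ∨ new)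
    where
    new : Bool
    new with vertexAt i
    ... | nothing = false
    ... | just x with parent x
    ...   | nothing = false
    ...   | just p = (eqᵇ b p ∧ nw a) ∨ (eqᵇ a p ∧ nw b)
      where
      -- u p ∈ E(H_{i+1}) because of u: either x u ∈ E(H_i), or exactly one
      -- of x u, p u is an edge of G
      nw : Fin N → Bool
      nw u = H i x u ∨ (adj G x u xor adj G p u)

  degreeH : ℕ → Fin N → ℕ
  degreeH i a = countTrue (map (λ b → H i a b) (allFin N))

  WidthLe : ℕ → Set
  WidthLe d = ∀ i → i < N → ∀ a → alive i a ≡ true → degreeH i a ≤ d

-- Both directions compare a trigraph sequence with the elimination sequence H_0, ..., H_n of a
-- decomposition through the trigraph of stage i: the vertices of H_i, with the edges of H_i red and
-- the remaining edges of G black.  Eliminating v_{i+1} into its parent p turns this trigraph of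
-- stage i into that of stage i+1 by contracting v_{i+1} and p, and the red degrees are the degrees
-- in H_i.  So a decomposition of width d yields a d-sequence.  Conversely, given a d-sequence,
-- name each vertex of each trigraph after a vertex of G, and when two vertices are contracted let
-- the <-smaller one be eliminated into the <-larger, which names the result; the trigraphs of the
-- sequence are then the stage trigraphs of this decomposition.  Parents are <-larger than their
-- children, so the root, reached from every vertex, is the <-maximum.

module Submission where

open import Defs hiding (sym)
open import Data.Nat using (ℕ; zero; suc; pred; _+_; _∸_; _≤_; z≤n; s≤s; s≤s⁻¹; _<?_)
  renaming (_<_ to _<ℕ_)
open import Data.Nat.Properties
  using ( +-commutativeSemigroup; +-suc; +-identityʳ; +-monoʳ-≤; pred[m∸n]≡m∸[1+n]
        ; m<n⇒0<n∸m; m∸n+n≡m; m≤m+n; m≤n+m; n≤1+n; 1+n≰n; ≤-refl; ≤-reflexive; ≤-trans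
        ; ≤-antisym; <⇒≤; ≤∧≢⇒<; <-irrefl; <-≤-trans; ≤-<-trans; <-cmp; ≮⇒≥; ≤ᵇ⇒≤; ≤⇒≤ᵇ)
open import Data.Fin using (Fin; zero; suc; punchIn; punchOut; toℕ; fromℕ; fromℕ<)
open import Data.Fin.Properties
  using ( toℕ-injective; toℕ<n; toℕ-fromℕ<; toℕ-fromℕ; suc-injective; punchIn-injective; punchInᵢ≢i
        ; punchOut-injective; punchIn-punchOut; punchOut-punchIn; punchOut-cong; any?; injective⇒≤)
  renaming (_≟_ to _≟ᶠ_)
open import Data.Bool using (Bool; true; false; _∧_; _∨_; not; _xor_)
open import Data.Bool.Properties using (∨-comm; ∨-identityʳ; T-≡)
open import Data.List using (_∷_; map; tabulate; allFin)
open import Data.List.Properties using (map-tabulate; tabulate-cong)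
open import Data.Sum using (_⊎_; inj₁; inj₂; [_,_])
import Data.Sum as Sum
open import Data.Product using (Σ; _×_; _,_; proj₁; proj₂; ∃)
import Data.Product as Product
open import Data.Empty using (⊥-elim)
open import Data.Maybe using (Maybe; just; nothing)
open import Data.Maybe.Properties using (just-injective)
open import Level using (0ℓ)
open import Relation.Binary.Core using (Rel)
open import Relation.Binary.Definitions using (Transitive; Tri; tri<; tri≈; tri>)
open import Relation.Binary.Structures using (IsStrictTotalOrder)
open import Relation.Binary.PropositionalEquality hiding ([_])
open import Relation.Nullary using (¬_; yes; no; Dec)
open import Relation.Nullary.Decidable using (dec-true; dec-false)
open import Function using (_∘_; id)
open import Function.Definitions using (Injective)
open import Function.Bundles using (Inverse; Equivalence; _↔_; mk↔ₛ′; _⇔_; mk⇔)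
open import Algebra.Properties.CommutativeSemigroup +-commutativeSemigroup using (x∙yz≈y∙xz)

bit : Bool → ℕ
bit true  = 1
bit false = 0

countTrue-∷ : ∀ b bs → countTrue (b ∷ bs) ≡ bit b + countTrue bs
countTrue-∷ true  bs = refl
countTrue-∷ false bs = refl

count : ∀ {m} → (Fin m → Bool) → ℕ
count P = countTrue (tabulate P)

countTrue-allFin : ∀ {m} (P : Fin m → Bool) → countTrue (map P (allFin m)) ≡ count P
countTrue-allFin P = cong countTrue (map-tabulate id P)

count-cong : ∀ {m} {P Q : Fin m → Bool} → (∀ a → P a ≡ Q a) → count P ≡ count Q
count-cong P≗Q = cong countTrue (tabulate-cong P≗Q)

count-false : ∀ {m} (P : Fin m → Bool) → (∀ a → P a ≡ false) → count P ≡ 0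
count-false {zero}  P P≡false = refl
count-false {suc m} P P≡false rewrite P≡false zero = count-false (P ∘ suc) (P≡false ∘ suc)

count-punchIn : ∀ {m} (P : Fin (suc m) → Bool) a → count P ≡ bit (P a) + count (P ∘ punchIn a)
count-punchIn P zero = countTrue-∷ (P zero) _
count-punchIn {suc m} P (suc a) = begin
  count P
    ≡⟨ countTrue-∷ (P zero) _ ⟩
  bit (P zero) + count (P ∘ suc)
    ≡⟨ cong (bit (P zero) +_) (count-punchIn (P ∘ suc) a) ⟩
  bit (P zero) + (bit (P (suc a)) + count (P ∘ suc ∘ punchIn a))
    ≡⟨ x∙yz≈y∙xz (bit (P zero)) (bit (P (suc a))) _ ⟩
  bit (P (suc a)) + (bit (P zero) + count (P ∘ suc ∘ punchIn a))
    ≡⟨ cong (bit (P (suc a)) +_) (sym (countTrue-∷ (P zero) _)) ⟩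
  bit (P (suc a)) + count (P ∘ punchIn (suc a)) ∎
  where open ≡-Reasoning

count-injective : ∀ {m N} (g : Fin m → Fin N) (P : Fin N → Bool) → Injective _≡_ _≡_ g →
                  (∀ b → P b ≡ true → ∃ λ c → g c ≡ b) → count (P ∘ g) ≡ count P
count-injective {zero} g P g-inj support = sym (count-false P P≡false)
  where
  P≡false : ∀ b → P b ≡ false
  P≡false b with P b in Pb
  ... | true  with () ← proj₁ (support b Pb)
  ... | false = refl
count-injective {suc m} {zero} g P g-inj support with () ← g zero
count-injective {suc m} {suc N} g P g-inj support = begin
  count (P ∘ g)
    ≡⟨ countTrue-∷ (P (g zero)) _ ⟩
  bit (P a) + count (P ∘ g ∘ suc)
    ≡⟨ cong (bit (P a) +_) (count-cong (λ c → cong P (sym (punchIn-punchOut (a≢g c))))) ⟩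
  bit (P a) + count (P ∘ punchIn a ∘ g′)
    ≡⟨ cong (bit (P a) +_) (count-injective g′ (P ∘ punchIn a) g′-inj support′) ⟩
  bit (P a) + count (P ∘ punchIn a)
    ≡⟨ sym (count-punchIn P a) ⟩
  count P ∎
  where
  open ≡-Reasoning
  a = g zero
  a≢g : ∀ c → a ≢ g (suc c)
  a≢g c a≡gc with () ← g-inj a≡gc
  g′ : Fin m → Fin N
  g′ c = punchOut (a≢g c)
  g′-inj : Injective _≡_ _≡_ g′
  g′-inj e = suc-injective (g-inj (punchOut-injective (a≢g _) (a≢g _) e))
  support′ : ∀ b → P (punchIn a b) ≡ true → ∃ λ c → g′ c ≡ b
  support′ b Pb with support (punchIn a b) Pb
  ... | zero  , a≡ = ⊥-elim (punchInᵢ≢i a b (sym a≡))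
  ... | suc c , g≡ = c , trans (punchOut-cong a g≡) (punchOut-punchIn a)

injective⇒surjective : ∀ {m} (f : Fin m → Fin m) → Injective _≡_ _≡_ f → ∀ c → ∃ λ a → f a ≡ c
injective⇒surjective {suc m} f f-inj c with any? (λ a → f a ≟ᶠ c)
... | yes hit = hit
... | no miss = ⊥-elim (1+n≰n (injective⇒≤ punchOut∘f-inj))
  where
  c≢f : ∀ a → c ≢ f a
  c≢f a c≡fa = miss (a , sym c≡fa)
  punchOut∘f-inj : Injective _≡_ _≡_ (λ a → punchOut (c≢f a))
  punchOut∘f-inj e = f-inj (punchOut-injective (c≢f _) (c≢f _) e)

-- Delete u from Fin (suc m), sending u itself where v goes.
redirect : ∀ {m} {u v : Fin (suc m)} → u ≢ v → Fin (suc m) → Fin m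
redirect {u = u} u≢v a with a ≟ᶠ u
... | yes _   = punchOut u≢v
... | no a≢u  = punchOut (a≢u ∘ sym)

module _ {m} {u v : Fin (suc m)} (u≢v : u ≢ v) where

  punchIn-redirect : ∀ {a} → a ≢ u → punchIn u (redirect u≢v a) ≡ a
  punchIn-redirect {a} a≢u with a ≟ᶠ u
  ... | yes a≡u = ⊥-elim (a≢u a≡u)
  ... | no a≢u′ = punchIn-punchOut (a≢u′ ∘ sym)

  punchIn-redirect-self : punchIn u (redirect u≢v u) ≡ v
  punchIn-redirect-self with u ≟ᶠ u
  ... | yes _   = punchIn-punchOut u≢v
  ... | no u≢u  = ⊥-elim (u≢u refl)

  redirect-merges : redirect u≢v u ≡ redirect u≢v v
  redirect-merges = punchIn-injective u _ _
    (trans punchIn-redirect-self (sym (punchIn-redirect (u≢v ∘ sym))))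

  private
    merged : ∀ {b} → redirect u≢v u ≡ redirect u≢v b → b ≢ u → b ≡ v
    merged {b} e b≢u = trans (sym (punchIn-redirect b≢u)) (trans (cong (punchIn u) (sym e)) punchIn-redirect-self)

  redirect-injective : ∀ {a b} → redirect u≢v a ≡ redirect u≢v b →
                       a ≡ b ⊎ (InUV u v a × InUV u v b)
  redirect-injective {a} {b} e = by-cases (a ≟ᶠ u) (b ≟ᶠ u)
    where
    by-cases : Dec (a ≡ u) → Dec (b ≡ u) → a ≡ b ⊎ (InUV u v a × InUV u v b)
    by-cases (yes a≡u)  (yes b≡u) = inj₁ (trans a≡u (sym b≡u))
    by-cases (yes refl) (no b≢u)  = inj₂ (inj₁ refl , inj₂ (merged e b≢u))
    by-cases (no a≢u)   (yes refl) = inj₂ (inj₂ (merged (sym e) a≢u) , inj₁ refl)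
    by-cases (no a≢u)   (no b≢u)  =
      inj₁ (trans (sym (punchIn-redirect a≢u)) (trans (cong (punchIn u) e) (punchIn-redirect b≢u)))

combine-comm : ∀ e f → combine e f ≡ combine f e
combine-comm none  none  = refl
combine-comm none  black = refl
combine-comm none  red   = refl
combine-comm black none  = refl
combine-comm black black = refl
combine-comm black red   = refl
combine-comm red   none  = refl
combine-comm red   black = refl
combine-comm red   red   = refl

-- A Contraction with named components; x is the vertex that will be eliminated into p.
record Merger {k} (S : Trigraph (suc (suc k))) (T : Trigraph (suc k)) : Set where
  field
    x p             : Fin (suc (suc k))
    x≢p             : x ≢ p
    merge           : Fin (suc (suc k)) → Fin (suc k)
    merges          : merge x ≡ merge p
    merge-injective : ∀ a b → merge a ≡ merge b → a ≡ b ⊎ (InUV x p a × InUV x p b)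
    edge-away       : ∀ a b → ¬ InUV x p a → ¬ InUV x p b → edge T (merge a) (merge b) ≡ edge S a b
    edge-merged     : ∀ y → ¬ InUV x p y → edge T (merge x) (merge y) ≡ combine (edge S x y) (edge S p y)

  InUV-≢x⇒≡p : ∀ {a} → InUV x p a → a ≢ x → a ≡ p
  InUV-≢x⇒≡p (inj₁ a≡x) a≢x = ⊥-elim (a≢x a≡x)
  InUV-≢x⇒≡p (inj₂ a≡p) _   = a≡p

  private
    merge-punchIn-injective : Injective _≡_ _≡_ (merge ∘ punchIn x)
    merge-punchIn-injective {a} {b} e with merge-injective _ _ e
    ... | inj₁ a≡b = punchIn-injective x a b a≡b
    ... | inj₂ (a∈ , b∈) =
          punchIn-injective x a b (trans (InUV-≢x⇒≡p a∈ (punchInᵢ≢i x a)) (sym (InUV-≢x⇒≡p b∈ (punchInᵢ≢i x b))))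

  origin : Fin (suc k) → Fin (suc (suc k))
  origin c = punchIn x (proj₁ (injective⇒surjective _ merge-punchIn-injective c))

  merge-origin : ∀ c → merge (origin c) ≡ c
  merge-origin c = proj₂ (injective⇒surjective _ merge-punchIn-injective c)

  origin≢x : ∀ c → origin c ≢ x
  origin≢x c = punchInᵢ≢i x _

  origin-injective : Injective _≡_ _≡_ origin
  origin-injective {c} {c′} e = trans (sym (merge-origin c)) (trans (cong merge e) (merge-origin c′))

  origin-merge : ∀ {a} → a ≢ x → origin (merge a) ≡ a
  origin-merge {a} a≢x with merge-injective _ _ (merge-origin (merge a))
  ... | inj₁ e = e
  ... | inj₂ (o∈ , a∈) = trans (InUV-≢x⇒≡p o∈ (origin≢x _)) (sym (InUV-≢x⇒≡p a∈ a≢x))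

toMerger : ∀ {k} {S : Trigraph (suc (suc k))} {T} → Contraction S T → Merger S T
toMerger (u , v , u≢v , f , fu≡fv , f-inj , away , merged) = record
  { x = u ; p = v ; x≢p = u≢v ; merge = f ; merges = fu≡fv ; merge-injective = f-inj
  ; edge-away = away ; edge-merged = merged }

swapMerger : ∀ {k} {S : Trigraph (suc (suc k))} {T} → Merger S T → Merger S T
swapMerger {S = S} {T} m = record
  { x = p ; p = x ; x≢p = x≢p ∘ sym ; merge = merge ; merges = sym merges
  ; merge-injective = λ a b e → Sum.map₂ (Product.map Sum.swap Sum.swap) (merge-injective a b e)
  ; edge-away = λ a b a∉ b∉ → edge-away a b (a∉ ∘ Sum.swap) (b∉ ∘ Sum.swap)
  ; edge-merged = λ y y∉ → begin
      edge T (merge p) (merge y)          ≡⟨ cong (λ z → edge T z (merge y)) (sym merges) ⟩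
      edge T (merge x) (merge y)          ≡⟨ edge-merged y (y∉ ∘ Sum.swap) ⟩
      combine (edge S x y) (edge S p y)   ≡⟨ combine-comm (edge S x y) _ ⟩
      combine (edge S p y) (edge S x y)   ∎
  }
  where
  open Merger m
  open ≡-Reasoning

∧-swap : ∀ x y r → x ∧ (y ∧ r) ≡ y ∧ (x ∧ r)
∧-swap true  y     r = refl
∧-swap false true  r = refl
∧-swap false false r = refl

module Elimination {N : ℕ} (G : Graph N) (D : TWDecomp G) where
  open TWDecomp D

  -- The term `new` of H (suc i), lifted out of its where-block so that it can be reasoned about;
  -- gains i x p is its `nw`.
  gains : ℕ → (x p u : Fin N) → Bool
  gains i x p u = H G D i x u ∨ (adj G x u xor adj G p u)

  newEdge : ℕ → Fin N → Fin N → Bool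
  newEdge i a b with vertexAt G D i
  ... | nothing = false
  ... | just x with parent x
  ...   | nothing = false
  ...   | just p = (eqᵇ G D b p ∧ gains i x p a) ∨ (eqᵇ G D a p ∧ gains i x p b)

  H-suc : ∀ i a b → H G D (suc i) a b ≡
          alive G D (suc i) a ∧ alive G D (suc i) b ∧ not (eqᵇ G D a b) ∧ (H G D i a b ∨ newEdge i a b)
  H-suc i a b with vertexAt G D i
  ... | nothing = refl
  ... | just x with parent x
  ...   | nothing = refl
  ...   | just p = refl

  newEdge-sym : ∀ i a b → newEdge i a b ≡ newEdge i b a
  newEdge-sym i a b with vertexAt G D i
  ... | nothing = refl
  ... | just x with parent x
  ...   | nothing = refl
  ...   | just p = ∨-comm (eqᵇ G D b p ∧ gains i x p a) _

  newEdge-at : ∀ {i x p} → vertexAt G D i ≡ just x → parent x ≡ just p → ∀ a b →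
               newEdge i a b ≡ (eqᵇ G D b p ∧ gains i x p a) ∨ (eqᵇ G D a p ∧ gains i x p b)
  newEdge-at {i} x-at x→p a b rewrite x-at | x→p = refl

  eqᵇ-refl : ∀ a → eqᵇ G D a a ≡ true
  eqᵇ-refl a = dec-true (a ≟ᶠ a) refl

  eqᵇ-false : ∀ {a b} → a ≢ b → eqᵇ G D a b ≡ false
  eqᵇ-false {a} {b} = dec-false (a ≟ᶠ b)

  eqᵇ-sym : ∀ a b → eqᵇ G D a b ≡ eqᵇ G D b a
  eqᵇ-sym a b with a ≟ᶠ b
  ... | yes refl = sym (eqᵇ-refl a)
  ... | no a≢b   = sym (eqᵇ-false (a≢b ∘ sym))

  H-irrefl : ∀ i a → H G D i a a ≡ false
  H-irrefl zero    a = refl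
  H-irrefl (suc i) a rewrite H-suc i a a | eqᵇ-refl a with alive G D (suc i) a
  ... | true  = refl
  ... | false = refl

  H-alive : ∀ i a b → H G D i a b ≡ true → alive G D i a ≡ true × alive G D i b ≡ true
  H-alive (suc i) a b h with alive G D (suc i) a | alive G D (suc i) b | trans (sym (H-suc i a b)) h
  ... | true  | true  | _ = refl , refl
  ... | true  | false | ()
  ... | false | _     | ()

  H-sym : ∀ i a b → H G D i a b ≡ H G D i b a
  H-sym zero    a b = refl
  H-sym (suc i) a b
    rewrite H-suc i a b | H-suc i b a | eqᵇ-sym a b | H-sym i a b | newEdge-sym i a b
    = ∧-swap (alive G D (suc i) a) (alive G D (suc i) b) _

  colour : (red? adjacent? : Bool) → Edge
  colour true  _     = red
  colour false true  = black
  colour false false = none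

  stageEdge : ℕ → Fin N → Fin N → Edge
  stageEdge i a b = colour (H G D i a b) (adj G a b)

  stageEdge-sym : ∀ i a b → stageEdge i a b ≡ stageEdge i b a
  stageEdge-sym i a b = cong₂ colour (H-sym i a b) (Graph.sym G a b)

  stageEdge-irrefl : ∀ i a → stageEdge i a a ≡ none
  stageEdge-irrefl i a = cong₂ colour (H-irrefl i a) (irrefl G a)

  isRed-colour : ∀ r e → isRed (colour r e) ≡ r
  isRed-colour true  e     = refl
  isRed-colour false true  = refl
  isRed-colour false false = refl

  -- The update of H at the parent p is the colour rule of contraction.
  combine-colour : ∀ rx ax rp ap →
    colour (rp ∨ (rx ∨ (ax xor ap))) ap ≡ combine (colour rx ax) (colour rp ap)
  combine-colour true  ax    true  ap    = refl
  combine-colour true  ax    false true  = refl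
  combine-colour true  ax    false false = refl
  combine-colour false true  true  ap    = refl
  combine-colour false false true  ap    = refl
  combine-colour false true  false true  = refl
  combine-colour false true  false false = refl
  combine-colour false false false true  = refl
  combine-colour false false false false = refl

  stageEdge-initial : ∀ a b → edge (toTrigraph G) a b ≡ stageEdge 0 a b
  stageEdge-initial a b with adj G a b
  ... | true  = refl
  ... | false = refl

  module EliminationStep {i x p} (x-at : vertexAt G D i ≡ just x) (x→p : parent x ≡ just p) where

    H-away : ∀ {a b} → a ≢ p → b ≢ p → alive G D (suc i) a ≡ true → alive G D (suc i) b ≡ true →
             H G D (suc i) a b ≡ H G D i a b
    H-away {a} {b} a≢p b≢p a-alive b-alive = by-cases (a ≟ᶠ b)
      where
      by-cases : Dec (a ≡ b) → H G D (suc i) a b ≡ H G D i a b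
      by-cases (yes refl) = trans (H-irrefl (suc i) a) (sym (H-irrefl i a))
      by-cases (no a≢b)
        rewrite H-suc i a b | newEdge-at x-at x→p a b | a-alive | b-alive
              | eqᵇ-false a≢b | eqᵇ-false a≢p | eqᵇ-false b≢p
        = ∨-identityʳ (H G D i a b)

    H-merged : ∀ {y} → y ≢ p → alive G D (suc i) y ≡ true → alive G D (suc i) p ≡ true →
               H G D (suc i) p y ≡ H G D i p y ∨ gains i x p y
    H-merged {y} y≢p y-alive p-alive
      rewrite H-suc i p y | newEdge-at x-at x→p p y | y-alive | p-alive
            | eqᵇ-false (y≢p ∘ sym) | eqᵇ-false y≢p | eqᵇ-refl p
      = refl

    stageEdge-away : ∀ {a b} → a ≢ p → b ≢ p → alive G D (suc i) a ≡ true → alive G D (suc i) b ≡ true →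
                     stageEdge (suc i) a b ≡ stageEdge i a b
    stageEdge-away {a} {b} a≢p b≢p a-alive b-alive =
      cong (λ r → colour r (adj G a b)) (H-away a≢p b≢p a-alive b-alive)

    stageEdge-merged : ∀ {y} → y ≢ p → alive G D (suc i) y ≡ true → alive G D (suc i) p ≡ true →
                       stageEdge (suc i) p y ≡ combine (stageEdge i x y) (stageEdge i p y)
    stageEdge-merged {y} y≢p y-alive p-alive =
      trans (cong (λ r → colour r (adj G p y)) (H-merged y≢p y-alive p-alive))
            (combine-colour (H G D i x y) (adj G x y) (H G D i p y) (adj G p y))

  -- S is (an isomorphic copy of) the trigraph of stage i, with vertex c of S standing for lab c.
  record Represents (i : ℕ) {k} (S : Trigraph k) (lab : Fin k → Fin N) : Set where
    field
      lab-injective : Injective _≡_ _≡_ lab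
      lab-alive     : ∀ c → alive G D i (lab c) ≡ true
      lab-onto      : ∀ a → alive G D i a ≡ true → ∃ λ c → lab c ≡ a
      edge-lab      : ∀ c c′ → edge S c c′ ≡ stageEdge i (lab c) (lab c′)

  redDegree-represented : ∀ {i k} {S : Trigraph k} {lab} → Represents i S lab →
                          ∀ c → redDegree S c ≡ degreeH G D i (lab c)
  redDegree-represented {i} {k} {S} {lab} rep c = begin
    redDegree S c                                  ≡⟨ countTrue-allFin (λ c′ → isRed (edge S c c′)) ⟩
    count (λ c′ → isRed (edge S c c′))             ≡⟨ count-cong isRed-edge ⟩
    count (λ c′ → H G D i (lab c) (lab c′))
      ≡⟨ count-injective lab (H G D i (lab c)) lab-injective support ⟩
    count (H G D i (lab c))                        ≡⟨ sym (countTrue-allFin (H G D i (lab c))) ⟩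
    degreeH G D i (lab c)                          ∎
    where
    open ≡-Reasoning
    open Represents rep
    isRed-edge : ∀ c′ → isRed (edge S c c′) ≡ H G D i (lab c) (lab c′)
    isRed-edge c′ = trans (cong isRed (edge-lab c c′)) (isRed-colour _ _)
    support : ∀ b → H G D i (lab c) b ≡ true → ∃ λ c′ → lab c′ ≡ b
    support b h = lab-onto b (proj₂ (H-alive i (lab c) b h))

  module MergedStage {i k} {S : Trigraph (suc (suc k))} {T} {lab : Fin (suc (suc k)) → Fin N} (m : Merger S T)
         (lab-inj : Injective _≡_ _≡_ lab)
         (x-at : vertexAt G D i ≡ just (lab (Merger.x m)))
         (x→p : parent (lab (Merger.x m)) ≡ just (lab (Merger.p m)))
         (alive-next : ∀ c → alive G D (suc i) (lab (Merger.origin m c)) ≡ true)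
         (S-edges : ∀ a b → edge S a b ≡ stageEdge i (lab a) (lab b)) where
    open Merger m
    open EliminationStep x-at x→p
    open ≡-Reasoning

    p-alive : alive G D (suc i) (lab p) ≡ true
    p-alive = subst (λ q → alive G D (suc i) (lab q) ≡ true) (origin-merge (x≢p ∘ sym)) (alive-next (merge p))

    lab≢p : ∀ {y} → y ≢ p → lab y ≢ lab p
    lab≢p y≢p e = y≢p (lab-inj e)

    edge-from-p : ∀ {y} → y ≢ x → y ≢ p → alive G D (suc i) (lab y) ≡ true →
                  edge T (merge p) (merge y) ≡ stageEdge (suc i) (lab p) (lab y)
    edge-from-p {y} y≢x y≢p y-alive = begin
      edge T (merge p) (merge y)          ≡⟨ cong (λ z → edge T z (merge y)) (sym merges) ⟩
      edge T (merge x) (merge y)          ≡⟨ edge-merged y [ y≢x , y≢p ] ⟩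
      combine (edge S x y) (edge S p y)   ≡⟨ cong₂ combine (S-edges x y) (S-edges p y) ⟩
      combine (stageEdge i (lab x) (lab y)) (stageEdge i (lab p) (lab y))
                                          ≡⟨ sym (stageEdge-merged (lab≢p y≢p) y-alive p-alive) ⟩
      stageEdge (suc i) (lab p) (lab y)   ∎

    edge-between : ∀ {a b} → a ≢ x → b ≢ x → a ≢ b →
                   alive G D (suc i) (lab a) ≡ true → alive G D (suc i) (lab b) ≡ true →
                   edge T (merge a) (merge b) ≡ stageEdge (suc i) (lab a) (lab b)
    edge-between {a} {b} a≢x b≢x a≢b a-alive b-alive = by-cases (a ≟ᶠ p) (b ≟ᶠ p)
      where
      by-cases : Dec (a ≡ p) → Dec (b ≡ p) → edge T (merge a) (merge b) ≡ stageEdge (suc i) (lab a) (lab b)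
      by-cases (yes a≡p) (yes b≡p) = ⊥-elim (a≢b (trans a≡p (sym b≡p)))
      by-cases (yes refl) (no b≢p) = edge-from-p b≢x b≢p b-alive
      by-cases (no a≢p) (yes refl) =
        trans (esym T (merge a) (merge p))
              (trans (edge-from-p a≢x a≢p a-alive) (stageEdge-sym (suc i) (lab p) (lab a)))
      by-cases (no a≢p) (no b≢p) = begin
        edge T (merge a) (merge b)          ≡⟨ edge-away a b [ a≢x , a≢p ] [ b≢x , b≢p ] ⟩
        edge S a b                          ≡⟨ S-edges a b ⟩
        stageEdge i (lab a) (lab b)         ≡⟨ sym (stageEdge-away (lab≢p a≢p) (lab≢p b≢p) a-alive b-alive) ⟩
        stageEdge (suc i) (lab a) (lab b)   ∎

    merged-stage : ∀ c c′ → edge T c c′ ≡ stageEdge (suc i) (lab (origin c)) (lab (origin c′))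
    merged-stage c c′ with c ≟ᶠ c′
    ... | yes refl = trans (eirref T c) (sym (stageEdge-irrefl (suc i) _))
    ... | no c≢c′  =
      trans (sym (cong₂ (edge T) (merge-origin c) (merge-origin c′)))
            (edge-between (origin≢x c) (origin≢x c′) (c≢c′ ∘ origin-injective) (alive-next c) (alive-next c′))

module Positions {n : ℕ} (G : Graph (suc n)) (D : TWDecomp G) where
  open TWDecomp D
  open Inverse pos using (to; from; strictlyInverseˡ; strictlyInverseʳ)

  position : Fin (suc n) → ℕ
  position a = toℕ (to a)

  position-injective : ∀ {a b} → position a ≡ position b → a ≡ b
  position-injective {a} {b} e =
    trans (sym (strictlyInverseʳ a)) (trans (cong from (toℕ-injective e)) (strictlyInverseʳ b))

  position≤n : ∀ a → position a ≤ n
  position≤n a = s≤s⁻¹ (toℕ<n (to a))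

  position-from : ∀ {i} (i<N : i <ℕ suc n) → position (from (fromℕ< i<N)) ≡ i
  position-from i<N = trans (cong toℕ (strictlyInverseˡ (fromℕ< i<N))) (toℕ-fromℕ< i<N)

  vertexAt-from : ∀ {i} (i<N : i <ℕ suc n) → vertexAt G D i ≡ just (from (fromℕ< i<N))
  vertexAt-from {i} i<N with i <? suc n
  ... | yes _    = refl
  ... | no i≮N   = ⊥-elim (i≮N i<N)

  alive⇒≤ : ∀ {i a} → alive G D i a ≡ true → i ≤ position a
  alive⇒≤ {i} {a} e = ≤ᵇ⇒≤ i (position a) (Equivalence.from T-≡ e)

  ≤⇒alive : ∀ {i a} → i ≤ position a → alive G D i a ≡ true
  ≤⇒alive i≤ = Equivalence.to T-≡ (≤⇒≤ᵇ i≤)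

  last-position : position (from (fromℕ n)) ≡ n
  last-position = trans (cong toℕ (strictlyInverseˡ (fromℕ n))) (toℕ-fromℕ n)

  root-position : position root ≡ n
  root-position with parent (from (fromℕ n)) in last→
  ... | nothing = trans (cong position (sym (proj₁ (rootOnly _) last→))) last-position
  ... | just q  = ⊥-elim (<-irrefl refl
                    (<-≤-trans (subst (_<ℕ position q) last-position (compat _ q last→)) (position≤n q)))

  parent-exists : ∀ a → position a <ℕ n → ∃ λ p → parent a ≡ just p
  parent-exists a a<n with parent a in a→
  ... | just p  = p , refl
  ... | nothing = ⊥-elim (<-irrefl (trans (cong position (proj₁ (rootOnly a) a→)) root-position) a<n)

iterParent-just : ∀ {N} (parent : Fin N → Maybe (Fin N)) k {v w} →
                  parent v ≡ just w → iterParent parent (suc k) v ≡ iterParent parent k w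
iterParent-just parent k v→w rewrite v→w = refl

module _ {N} (parent : Fin N → Maybe (Fin N)) (rank : Fin N → ℕ) {bound : ℕ} {root : Fin N}
         (rank≤bound : ∀ v → rank v ≤ bound)
         (rank-increases : ∀ {v w} → parent v ≡ just w → rank v <ℕ rank w)
         (parentless-root : ∀ {v} → parent v ≡ nothing → v ≡ root) where

  reaches-root : ∀ v → ∃ λ k → iterParent parent k v ≡ just root
  reaches-root v = climb bound v (m≤m+n bound (rank v))
    where
    climb : ∀ fuel v → bound ≤ fuel + rank v → ∃ λ k → iterParent parent k v ≡ just root
    climb fuel v enough with parent v in v→
    ... | nothing = 0 , cong just (parentless-root v→)
    ... | just w with fuel
    ...   | zero = ⊥-elim (<-irrefl refl (≤-<-trans enough (<-≤-trans (rank-increases v→) (rank≤bound w))))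
    ...   | suc fuel′ =
            let k , w↝root = climb fuel′ w (≤-trans enough (subst (_≤ fuel′ + rank w) (+-suc fuel′ (rank v))
                                                                 (+-monoʳ-≤ fuel′ (rank-increases v→))))
            in suc k , trans (iterParent-just parent k v→) w↝root

module _ {N} (T : RootedTree N) {ℓ} {_≺_ : Rel (Fin N) ℓ} (≺-trans : Transitive _≺_)
         (parent-≺ : ∀ x y → RootedTree.parent T y ≡ just x → y ≺ x) where
  open RootedTree T

  ancestor-≺ : ∀ k v {w} → iterParent parent (suc k) v ≡ just w → v ≺ w
  ancestor-≺ k v v↝w with parent v in v→
  ... | just u with k
  ...   | zero    = subst (v ≺_) (just-injective v↝w) (parent-≺ u v v→)
  ...   | suc k′  = ≺-trans (parent-≺ u v v→) (ancestor-≺ k′ u v↝w)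

  root-greatest : ∀ v → v ≢ root → v ≺ root
  root-greatest v v≢root with reachRoot v
  ... | zero  , v↝root = ⊥-elim (v≢root (just-injective v↝root))
  ... | suc k , v↝root = ancestor-≺ k v v↝root

module FromDecomposition {n : ℕ} (G : Graph (suc n)) (D : TWDecomp G) {d : ℕ} (width : WidthLe G D d) where
  open TWDecomp D
  open Elimination G D
  open Positions G D

  represented-bounded : ∀ {i k} {T : Trigraph k} {lab} → i <ℕ suc n → Represents i T lab → IsDTrigraph d T
  represented-bounded {i} i<N rep c rewrite redDegree-represented rep c =
    width i i<N _ (Represents.lab-alive rep c)

  initial : Represents 0 (toTrigraph G) id
  initial = record
    { lab-injective = id
    ; lab-alive     = λ _ → refl
    ; lab-onto      = λ a _ → a , refl
    ; edge-lab      = stageEdge-initial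
    }

  module NextStage {i k} {S : Trigraph (suc (suc k))} {lab} (i<n : i <ℕ n) (rep : Represents i S lab) where
    open Represents rep

    i<N : i <ℕ suc n
    i<N = <-≤-trans i<n (n≤1+n n)

    x : Fin (suc n)
    x = Inverse.from pos (fromℕ< i<N)

    x-position : position x ≡ i
    x-position = position-from i<N

    p : Fin (suc n)
    p = proj₁ (parent-exists x (subst (_<ℕ n) (sym x-position) i<n))

    x→p : parent x ≡ just p
    x→p = proj₂ (parent-exists x (subst (_<ℕ n) (sym x-position) i<n))

    i<p : i <ℕ position p
    i<p = subst (_<ℕ position p) x-position (compat x p x→p)

    open EliminationStep (vertexAt-from i<N) x→p

    u v : Fin (suc (suc k))
    u = proj₁ (lab-onto x (≤⇒alive (≤-reflexive (sym x-position))))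
    v = proj₁ (lab-onto p (≤⇒alive (<⇒≤ i<p)))

    u↦x : lab u ≡ x
    u↦x = proj₂ (lab-onto x (≤⇒alive (≤-reflexive (sym x-position))))

    v↦p : lab v ≡ p
    v↦p = proj₂ (lab-onto p (≤⇒alive (<⇒≤ i<p)))

    u≢later : ∀ {c a} → lab c ≡ a → i <ℕ position a → u ≢ c
    u≢later c↦a i<a u≡c =
      <-irrefl (trans (sym x-position) (cong position (trans (sym u↦x) (trans (cong lab u≡c) c↦a)))) i<a

    u≢v : u ≢ v
    u≢v = u≢later v↦p i<p

    only-u-at-i : ∀ {c} → position (lab c) ≡ i → c ≡ u
    only-u-at-i e = lab-injective (position-injective (trans e (trans (sym x-position) (cong position (sym u↦x)))))

    survives : ∀ {c} → c ≢ u → alive G D (suc i) (lab c) ≡ true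
    survives {c} c≢u = ≤⇒alive (≤∧≢⇒< (alive⇒≤ (lab-alive c)) (c≢u ∘ only-u-at-i ∘ sym))

    lab≢p : ∀ {c} → c ≢ v → lab c ≢ p
    lab≢p c≢v lab≡p = c≢v (lab-injective (trans lab≡p (sym v↦p)))

    merge : Fin (suc (suc k)) → Fin (suc k)
    merge = redirect u≢v

    lab′ : Fin (suc k) → Fin (suc n)
    lab′ = lab ∘ punchIn u

    T : Trigraph (suc k)
    T = record
      { edge   = λ c c′ → stageEdge (suc i) (lab′ c) (lab′ c′)
      ; esym   = λ c c′ → stageEdge-sym (suc i) (lab′ c) (lab′ c′)
      ; eirref = λ c → stageEdge-irrefl (suc i) (lab′ c)
      }

    edge-away : ∀ a b → ¬ InUV u v a → ¬ InUV u v b → edge T (merge a) (merge b) ≡ edge S a b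
    edge-away a b a∉ b∉ = begin
      stageEdge (suc i) (lab′ (merge a)) (lab′ (merge b))
        ≡⟨ cong₂ (λ a′ b′ → stageEdge (suc i) (lab a′) (lab b′))
                 (punchIn-redirect u≢v (a∉ ∘ inj₁)) (punchIn-redirect u≢v (b∉ ∘ inj₁)) ⟩
      stageEdge (suc i) (lab a) (lab b)
        ≡⟨ stageEdge-away (lab≢p (a∉ ∘ inj₂)) (lab≢p (b∉ ∘ inj₂))
                          (survives (a∉ ∘ inj₁)) (survives (b∉ ∘ inj₁)) ⟩
      stageEdge i (lab a) (lab b)
        ≡⟨ sym (edge-lab a b) ⟩
      edge S a b ∎
      where open ≡-Reasoning

    edge-merged : ∀ y → ¬ InUV u v y → edge T (merge u) (merge y) ≡ combine (edge S u y) (edge S v y)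
    edge-merged y y∉ = begin
      stageEdge (suc i) (lab′ (merge u)) (lab′ (merge y))
        ≡⟨ cong₂ (λ a′ b′ → stageEdge (suc i) (lab a′) (lab b′))
                 (punchIn-redirect-self u≢v) (punchIn-redirect u≢v (y∉ ∘ inj₁)) ⟩
      stageEdge (suc i) (lab v) (lab y)
        ≡⟨ cong (λ q → stageEdge (suc i) q (lab y)) v↦p ⟩
      stageEdge (suc i) p (lab y)
        ≡⟨ stageEdge-merged (lab≢p (y∉ ∘ inj₂)) (survives (y∉ ∘ inj₁))
                            (subst (λ q → alive G D (suc i) q ≡ true) v↦p (survives (u≢v ∘ sym))) ⟩
      combine (stageEdge i x (lab y)) (stageEdge i p (lab y))
        ≡⟨ sym (cong₂ (λ x′ p′ → combine (stageEdge i x′ (lab y)) (stageEdge i p′ (lab y)))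
                      u↦x v↦p) ⟩
      combine (stageEdge i (lab u) (lab y)) (stageEdge i (lab v) (lab y))
        ≡⟨ sym (cong₂ combine (edge-lab u y) (edge-lab v y)) ⟩
      combine (edge S u y) (edge S v y) ∎
      where open ≡-Reasoning

    contraction : Contraction S T
    contraction =
      u , v , u≢v , merge , redirect-merges u≢v , (λ _ _ → redirect-injective u≢v) , edge-away , edge-merged

    lab′-onto : ∀ a → alive G D (suc i) a ≡ true → ∃ λ c → lab′ c ≡ a
    lab′-onto a a-alive with lab-onto a (≤⇒alive (<⇒≤ (alive⇒≤ a-alive)))
    ... | c , c↦a = punchOut u≢c , trans (cong lab (punchIn-punchOut u≢c)) c↦a
      where
      u≢c : u ≢ c
      u≢c = u≢later c↦a (alive⇒≤ a-alive)

    represents-next : Represents (suc i) T lab′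
    represents-next = record
      { lab-injective = λ e → punchIn-injective u _ _ (lab-injective e)
      ; lab-alive     = λ c → survives (punchInᵢ≢i u c)
      ; lab-onto      = lab′-onto
      ; edge-lab      = λ _ _ → refl
      }

  build : ∀ k i → k + i ≡ n → ∀ {S : Trigraph (suc k)} {lab} → Represents i S lab → ContrSeq d S
  build zero    i _     {S} _   = done S
  build (suc k) i k+i≡n     rep =
    step T contraction (represented-bounded (s≤s i<n) represents-next)
         (build k (suc i) (trans (+-suc k i) k+i≡n) represents-next)
    where
    i<n : i <ℕ n
    i<n = subst (i <ℕ_) k+i≡n (s≤s (m≤n+m i k))
    open NextStage i<n rep

  decomposition⇒tww : TwwLe G d
  decomposition⇒tww = d , ≤-refl , represented-bounded (s≤s z≤n) initial , build n 0 (+-identityʳ n) initial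

module ToDecomposition {n : ℕ} (G : Graph (suc n))
                       {_<_ : Rel (Fin (suc n)) 0ℓ} (<-sto : IsStrictTotalOrder _≡_ _<_)
                       {d′ : ℕ} (bounded₀ : IsDTrigraph d′ (toTrigraph G))
                       (sequence₀ : ContrSeq d′ (toTrigraph G)) where
  open IsStrictTotalOrder <-sto using (compare)

  Ascending : ∀ {k} {S : Trigraph (suc (suc k))} {T} → (Fin (suc (suc k)) → Fin (suc n)) → Merger S T → Set
  Ascending lab m = lab (Merger.x m) < lab (Merger.p m)

  orient : ∀ {k} (S : Trigraph (suc (suc k))) T (lab : Fin (suc (suc k)) → Fin (suc n)) →
           Injective _≡_ _≡_ lab → Contraction S T → Σ (Merger S T) (Ascending lab)
  orient S T lab lab-inj con = by-order (compare (lab x) (lab p))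
    where
    open Merger (toMerger {S = S} {T} con)
    by-order : Tri (lab x < lab p) (lab x ≡ lab p) (lab p < lab x) → Σ (Merger S T) (Ascending lab)
    by-order (tri< x<p _ _) = toMerger con , x<p
    by-order (tri≈ _ x≡p _) = ⊥-elim (x≢p (lab-inj x≡p))
    by-order (tri> _ _ p<x) = swapMerger (toMerger con) , p<x

  record Stage : Set where
    constructor stage
    field
      {k}           : ℕ
      S             : Trigraph (suc k)
      sequence      : ContrSeq d′ S
      S-bounded     : IsDTrigraph d′ S
      lab           : Fin (suc k) → Fin (suc n)
      lab-injective : Injective _≡_ _≡_ lab

  open Stage

  Active : Stage → Set
  Active st = 0 <ℕ k st

  Label : Stage → Fin (suc n) → Set
  Label st a = ∃ λ c → lab st c ≡ a

  advance : Stage → Stage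
  advance st@(stage _ (done _) _ _ _) = st
  advance (stage S (step T con T-bounded rest) _ lab lab-inj) =
    stage T rest T-bounded (lab ∘ origin) (origin-injective ∘ lab-inj)
    where open Merger (proj₁ (orient S T lab lab-inj con))

  -- On the final one-vertex stage both are that vertex.
  eliminated absorbed : Stage → Fin (suc n)
  eliminated (stage _ (done _) _ lab _) = lab zero
  eliminated (stage S (step T con _ _) _ lab lab-inj) = lab (Merger.x (proj₁ (orient S T lab lab-inj con)))
  absorbed (stage _ (done _) _ lab _) = lab zero
  absorbed (stage S (step T con _ _) _ lab lab-inj) = lab (Merger.p (proj₁ (orient S T lab lab-inj con)))

  k-advance : ∀ st → k (advance st) ≡ pred (k st)
  k-advance (stage _ (done _) _ _ _)     = refl
  k-advance (stage _ (step _ _ _ _) _ _ _) = refl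

  eliminated-label : ∀ st → Label st (eliminated st)
  eliminated-label (stage _ (done _) _ _ _)     = zero , refl
  eliminated-label (stage S (step T con _ _) _ lab lab-inj) = Merger.x (proj₁ (orient S T lab lab-inj con)) , refl

  label-advance : ∀ st {a} → Label (advance st) a → Label st a
  label-advance (stage _ (done _) _ _ _) ℓ = ℓ
  label-advance (stage S (step T con _ _) _ lab lab-inj) (c , c↦a) = origin c , c↦a
    where open Merger (proj₁ (orient S T lab lab-inj con))

  eliminated-gone : ∀ st → Active st → ¬ Label (advance st) (eliminated st)
  eliminated-gone (stage S (step T con _ _) _ lab lab-inj) _ (c , c↦x) = origin≢x c (lab-inj c↦x)
    where open Merger (proj₁ (orient S T lab lab-inj con))

  absorbed-survives : ∀ st → Active st → Label (advance st) (absorbed st)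
  absorbed-survives (stage S (step T con _ _) _ lab lab-inj) _ = merge p , cong lab (origin-merge (x≢p ∘ sym))
    where open Merger (proj₁ (orient S T lab lab-inj con))

  eliminated<absorbed : ∀ st → Active st → eliminated st < absorbed st
  eliminated<absorbed (stage S (step T con _ _) _ lab lab-inj) _ = proj₂ (orient S T lab lab-inj con)

  stages : ℕ → Stage
  stages zero    = stage (toTrigraph G) sequence₀ bounded₀ id id
  stages (suc i) = advance (stages i)

  remaining : ∀ i → k (stages i) ≡ n ∸ i
  remaining zero    = refl
  remaining (suc i) = trans (k-advance (stages i)) (trans (cong pred (remaining i)) (pred[m∸n]≡m∸[1+n] n i))

  active : ∀ {i} → i <ℕ n → Active (stages i)
  active {i} i<n = subst (0 <ℕ_) (sym (remaining i)) (m<n⇒0<n∸m i<n)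

  label-mono : ∀ {i j a} → i ≤ j → Label (stages j) a → Label (stages i) a
  label-mono {i} {j} i≤j =
    subst (λ j → Label (stages j) _ → Label (stages i) _) (m∸n+n≡m i≤j) (earlier (j ∸ i))
    where
    earlier : ∀ m {a} → Label (stages (m + i)) a → Label (stages i) a
    earlier zero    ℓ = ℓ
    earlier (suc m) ℓ = earlier m (label-advance (stages (m + i)) ℓ)

  eliminatedAt absorbedAt : ℕ → Fin (suc n)
  eliminatedAt i = eliminated (stages i)
  absorbedAt i = absorbed (stages i)

  eliminatedAt-gone : ∀ {i j} → i <ℕ n → i <ℕ j → ¬ Label (stages j) (eliminatedAt i)
  eliminatedAt-gone {i} i<n i<j = eliminated-gone (stages i) (active i<n) ∘ label-mono i<j

  eliminatedAt-distinct : ∀ {i j} → i <ℕ j → j ≤ n → eliminatedAt i ≢ eliminatedAt j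
  eliminatedAt-distinct {i} {j} i<j j≤n e =
    eliminatedAt-gone (<-≤-trans i<j j≤n) i<j (subst (Label (stages j)) (sym e) (eliminated-label (stages j)))

  order : Fin (suc n) → Fin (suc n)
  order j = eliminatedAt (toℕ j)

  order-injective : Injective _≡_ _≡_ order
  order-injective {j} {j′} e with <-cmp (toℕ j) (toℕ j′)
  ... | tri< j<j′ _ _ = ⊥-elim (eliminatedAt-distinct j<j′ (s≤s⁻¹ (toℕ<n j′)) e)
  ... | tri≈ _ j≡j′ _ = toℕ-injective j≡j′
  ... | tri> _ _ j′<j = ⊥-elim (eliminatedAt-distinct j′<j (s≤s⁻¹ (toℕ<n j)) (sym e))

  rank : Fin (suc n) → Fin (suc n)
  rank a = proj₁ (injective⇒surjective order order-injective a)

  order-rank : ∀ a → order (rank a) ≡ a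
  order-rank a = proj₂ (injective⇒surjective order order-injective a)

  rank-order : ∀ j → rank (order j) ≡ j
  rank-order j = order-injective (order-rank (order j))

  elimination : Fin (suc n) ↔ Fin (suc n)
  elimination = mk↔ₛ′ rank order rank-order order-rank

  position : Fin (suc n) → ℕ
  position a = toℕ (rank a)

  eliminatedAt-position : ∀ a → eliminatedAt (position a) ≡ a
  eliminatedAt-position = order-rank

  position-eliminatedAt : ∀ {i} → i ≤ n → position (eliminatedAt i) ≡ i
  position-eliminatedAt {i} i≤n = begin
    position (eliminatedAt i)             ≡⟨ cong (position ∘ eliminatedAt) (sym (toℕ-fromℕ< i<N)) ⟩
    position (order (fromℕ< i<N))         ≡⟨ cong toℕ (rank-order _) ⟩
    toℕ (fromℕ< i<N)                      ≡⟨ toℕ-fromℕ< i<N ⟩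
    i                                     ∎
    where
    open ≡-Reasoning
    i<N = s≤s i≤n

  labelled⇒after : ∀ {i a} → i ≤ n → Label (stages i) a → i ≤ position a
  labelled⇒after {i} {a} i≤n ℓ = ≮⇒≥ λ a<i →
    eliminatedAt-gone (<-≤-trans a<i i≤n) a<i (subst (Label (stages i)) (sym (eliminatedAt-position a)) ℓ)

  after⇒labelled : ∀ {i a} → i ≤ position a → Label (stages i) a
  after⇒labelled {i} {a} i≤a =
    label-mono i≤a (subst (Label (stages (position a))) (eliminatedAt-position a)
                          (eliminated-label (stages (position a))))

  position≤n : ∀ a → position a ≤ n
  position≤n a = s≤s⁻¹ (toℕ<n (rank a))

  parentOf : Fin (suc n) → Maybe (Fin (suc n))
  parentOf a with position a <? n
  ... | yes _ = just (absorbedAt (position a))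
  ... | no _  = nothing

  parentOf-just : ∀ {a b} → parentOf a ≡ just b → position a <ℕ n × b ≡ absorbedAt (position a)
  parentOf-just {a} a→b with position a <? n
  ... | yes a<n = a<n , sym (just-injective a→b)

  parentOf-nothing : ∀ {a} → parentOf a ≡ nothing → position a ≡ n
  parentOf-nothing {a} _ with position a <? n
  ... | no a≮n = ≤-antisym (position≤n a) (≮⇒≥ a≮n)

  parentOf-eliminatedAt : ∀ {i} → i <ℕ n → parentOf (eliminatedAt i) ≡ just (absorbedAt i)
  parentOf-eliminatedAt {i} i<n with position (eliminatedAt i) <? n | position-eliminatedAt (<⇒≤ i<n)
  ... | yes _   | e = cong (just ∘ absorbedAt) e
  ... | no i≮n | e = ⊥-elim (i≮n (subst (_<ℕ n) (sym e) i<n))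

  root : Fin (suc n)
  root = eliminatedAt n

  position-increases : ∀ {a b} → parentOf a ≡ just b → position a <ℕ position b
  position-increases {a} a→b with parentOf-just a→b
  ... | a<n , refl = labelled⇒after a<n (absorbed-survives (stages (position a)) (active a<n))

  parent-< : ∀ x y → parentOf y ≡ just x → y < x
  parent-< x y y→x with parentOf-just y→x
  ... | y<n , refl = subst (_< absorbedAt (position y)) (eliminatedAt-position y)
                           (eliminated<absorbed (stages (position y)) (active y<n))

  parentless-root : ∀ {a} → parentOf a ≡ nothing → a ≡ root
  parentless-root {a} a↛ = trans (sym (eliminatedAt-position a)) (cong eliminatedAt (parentOf-nothing a↛))

  root-parentless : ∀ {a} → a ≡ root → parentOf a ≡ nothing
  root-parentless refl with position root <? n
  ... | yes root<n = ⊥-elim (<-irrefl (position-eliminatedAt ≤-refl) root<n)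
  ... | no _       = refl

  tree : RootedTree (suc n)
  tree = record
    { root      = root
    ; parent    = parentOf
    ; rootOnly  = λ _ → parentless-root , root-parentless
    ; reachRoot = reaches-root parentOf position position≤n position-increases parentless-root
    }

  decomposition : TWDecomp G
  decomposition = record { tree = tree ; pos = elimination ; compat = λ _ _ → position-increases }

  open Elimination G decomposition
  open Positions G decomposition using (≤⇒alive; alive⇒≤; vertexAt-from)

  Agrees : ℕ → Stage → Set
  Agrees i st = ∀ c c′ → edge (S st) c c′ ≡ stageEdge i (lab st c) (lab st c′)

  agrees-advance : ∀ {i} st → Active st →
                   vertexAt G decomposition i ≡ just (eliminated st) →
                   parentOf (eliminated st) ≡ just (absorbed st) →
                   (∀ c → alive G decomposition (suc i) (lab (advance st) c) ≡ true) →
                   Agrees i st → Agrees (suc i) (advance st)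
  agrees-advance (stage S (step T con _ _) _ lab lab-inj) _ x-at x→p alive-next S-edges =
    MergedStage.merged-stage (proj₁ (orient S T lab lab-inj con)) lab-inj x-at x→p alive-next S-edges

  stages-agree : ∀ i → i ≤ n → Agrees i (stages i)
  stages-agree zero    _   = stageEdge-initial
  stages-agree (suc i) i<n =
    agrees-advance (stages i) (active i<n)
      (trans (vertexAt-from i<N) (cong (just ∘ eliminatedAt) (toℕ-fromℕ< i<N)))
      (parentOf-eliminatedAt i<n)
      (λ c → ≤⇒alive (labelled⇒after i<n (c , refl)))
      (stages-agree i (<⇒≤ i<n))
    where
    i<N : i <ℕ suc n
    i<N = <-≤-trans i<n (n≤1+n n)

  represents : ∀ {i} → i ≤ n → Represents i (S (stages i)) (lab (stages i))
  represents {i} i≤n = record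
    { lab-injective = lab-injective (stages i)
    ; lab-alive     = λ c → ≤⇒alive (labelled⇒after i≤n (c , refl))
    ; lab-onto      = λ a a-alive → after⇒labelled {i} (alive⇒≤ a-alive)
    ; edge-lab      = stages-agree i i≤n
    }

  width : ∀ {d} → d′ ≤ d → WidthLe G decomposition d
  width d′≤d i i<N a a-alive with after⇒labelled {i} (alive⇒≤ a-alive)
  ... | c , refl =
    ≤-trans (subst (_≤ d′) (redDegree-represented (represents (s≤s⁻¹ i<N)) c) (S-bounded (stages i) c)) d′≤d

theorem1 : ∀ {n : ℕ} (G : Graph (suc n)) (d : ℕ) (_<_ : Rel (Fin (suc n)) 0ℓ) →
    IsStrictTotalOrder _≡_ _<_ →
    TwwLe G d ⇔
      Σ (TWDecomp G) λ D →
        WidthLe G D d ×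
        (∀ x y → TWDecomp.parent D y ≡ just x → y < x) ×
        (∀ v → v ≢ TWDecomp.root D → v < TWDecomp.root D)
theorem1 G d _<_ <-sto = mk⇔ forward backward
  where
  Ordered : TWDecomp G → Set
  Ordered D = (∀ x y → TWDecomp.parent D y ≡ just x → y < x) ×
              (∀ v → v ≢ TWDecomp.root D → v < TWDecomp.root D)

  forward : TwwLe G d → Σ (TWDecomp G) λ D → WidthLe G D d × Ordered D
  forward (d′ , d′≤d , bounded₀ , sequence₀) =
    decomposition , width d′≤d , parent-< , root-greatest tree (IsStrictTotalOrder.trans <-sto) parent-<
    where open ToDecomposition G <-sto bounded₀ sequence₀

  backward : (Σ (TWDecomp G) λ D → WidthLe G D d × Ordered D) → TwwLe G d
  backward (D , D-width , _) = FromDecomposition.decomposition⇒tww G D D-width
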